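{- Let $q$ be a prime power, $n\ge2$, $m\ge1$, and let $\mathcal C\subseteq\mathbb F_q^{n\times m}$ be a nondegenerate $\mathbb F_q$-linear subspace of dimension $k$ with generator tensor $T\in\mathbb F_q^{k\times n\times m}$. Let $N=(q^n-1)/(q-1)$, let $u_1,\dots,u_N\in\mathbb F_q^n\setminus\{0\}$ be representatives of the points of the projective space $\mathbb P(\mathbb F_q^n)$, set $M_i:=m_2(u_i,T)\in\mathbb F_q^{k\times m}$, and let $\mathcal C^{\mathrm{AH}}$ be the row space of the block matrix $(M_1\ M_2\ \cdots\ M_N)\in\mathbb F_q^{k\times mN}$. Then the projectivization $\operatorname{Proj}(\mathcal M[\mathcal C])$ is equivalent to the polymatroid induced by $\mathcal C^{\mathrm{AH}}$; that is, the bijection $\psi:\mathbb P(\mathbb F_q^n)\to[N]$, $\langle u_i\rangle\mapsto i$, satisfies $r_{\operatorname{Proj}(\mathcal M[\mathcal C])}(A)=r_{\mathcal C^{\mathrm{AH}}}(\psi(A))$ for all $A\subseteq\mathbb P(\mathbb F_q^n)$.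
   Context: For $W\subseteq\mathbb F_q^n$, $\mathcal C(W)=\{M\in\mathcal C:\operatorname{colsp}(M)\subseteq W\}$; $\mathcal M[\mathcal C]$ is the $q$-polymatroid on $\mathbb F_q^n$ with rank function $\rho_{\mathcal C}(U)=(k-\dim\mathcal C(U^\perp))/m$, where $U^\perp$ is the orthogonal complement under the standard dot product. $\mathcal C$ is nondegenerate if the sum of the column spaces of its elements is $\mathbb F_q^n$ and the sum of their row spaces is $\mathbb F_q^m$. A tensor $T\in\mathbb F_q^{k\times n\times m}$ with entries $T_{a,b,c}$ is a generator tensor of $\mathcal C$ if the $\mathbb F_q$-span of the $k$ matrices $(T_{a,b,c})_{b,c}\in\mathbb F_q^{n\times m}$ equals $\mathcal C$. For a row vector $u\in\mathbb F_q^n$, $m_2(u,T)\in\mathbb F_q^{k\times m}$ is the matrix with entries $\sum_{b}u_bT_{a,b,c}$. The projectivization $\operatorname{Proj}(\mathcal M)$ of a $q$-polymatroid $(\mathcal L(\mathbb F_q^n),\rho)$ is the polymatroid on ground set $\mathbb P(\mathbb F_q^n)$ with rank $r(A)=\rho(\langle A\rangle)$, $\langle A\rangle$ the span of representatives of the points in $A$. The polymatroid induced by $\mathcal C^{\mathrm{AH}}$ is on $[N]$ with rank function $r_{\mathcal C^{\mathrm{AH}}}(\{i_1,\dots,i_s\})=\frac1m\dim_{\mathbb F_q}\operatorname{rowsp}(M_{i_1}\ \cdots\ M_{i_s})$ (and $0$ on the empty set). -}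

module Defs where

open import Level using (Level; _⊔_)
open import Algebra.Bundles using (CommutativeRing)
open import Data.Nat using (ℕ; zero; suc; _≤_; _^_)
open import Data.Nat.Primality using (Prime)
open import Data.Fin using (Fin)
import Data.Fin as Fin
open import Data.Fin.Subset using (Subset; _∈_)
open import Data.Product using (Σ; ∃; _×_; _,_)
open import Relation.Nullary using (¬_)
open import Relation.Binary.PropositionalEquality using (_≡_)

IsPrimePower : ℕ → Set
IsPrimePower q = Σ ℕ λ p → Σ ℕ λ r → Prime p × (1 ≤ r) × (q ≡ p ^ r)

module _ {c ℓ : Level} (R : CommutativeRing c ℓ) where
  open CommutativeRing R

  IsField : Set (c ⊔ ℓ)
  IsField = (¬ (1# ≈ 0#)) × (∀ x → ¬ (x ≈ 0#) → Σ Carrier λ y → x * y ≈ 1#)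

  HasCard : ℕ → Set (c ⊔ ℓ)
  HasCard q = Σ (Fin q → Carrier) λ e →
    (∀ i j → e i ≈ e j → i ≡ j) × (∀ x → Σ (Fin q) λ i → x ≈ e i)

  Vect : Set → Set c
  Vect I = I → Carrier

  _≈v_ : {I : Set} → Vect I → Vect I → Set ℓ
  u ≈v v = ∀ i → u i ≈ v i

  zeroV : {I : Set} → Vect I
  zeroV _ = 0#

  _•_ : {I : Set} → Carrier → Vect I → Vect I
  (a • v) i = a * v i

  sumF : {s : ℕ} → (Fin s → Carrier) → Carrier
  sumF {zero} f = 0#
  sumF {suc s} f = f Fin.zero + sumF (λ j → f (Fin.suc j))

  lincomb : {I : Set} {s : ℕ} → (Fin s → Carrier) → (Fin s → Vect I) → Vect I
  lincomb cs w i = sumF (λ j → cs j * w j i)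

  SpanFam : {I : Set} {s : ℕ} → (Fin s → Vect I) → Vect I → Set (c ⊔ ℓ)
  SpanFam w v = Σ (Fin _ → Carrier) λ cs → v ≈v lincomb cs w

  SpanP : {I : Set} {p : Level} → (Vect I → Set p) → Vect I → Set (c ⊔ ℓ ⊔ p)
  SpanP P v = Σ ℕ λ s → Σ (Fin s → Vect _) λ w → (∀ j → P (w j)) × SpanFam w v

  LinIndep : {I : Set} {s : ℕ} → (Fin s → Vect I) → Set (c ⊔ ℓ)
  LinIndep w = ∀ cs → lincomb cs w ≈v zeroV → ∀ j → cs j ≈ 0#

  IsDim : {I : Set} {p : Level} → (Vect I → Set p) → ℕ → Set (c ⊔ ℓ ⊔ p)
  IsDim P d = Σ (Fin d → Vect _) λ b →
    (∀ j → P (b j)) × LinIndep b × (∀ v → P v → SpanFam b v)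

  dot : {n : ℕ} → Vect (Fin n) → Vect (Fin n) → Carrier
  dot u v = sumF (λ b → u b * v b)

  Perp : {n : ℕ} {p : Level} → (Vect (Fin n) → Set p) → Vect (Fin n) → Set (c ⊔ ℓ ⊔ p)
  Perp U v = ∀ u → U u → dot u v ≈ 0#

  Mat : ℕ → ℕ → Set c
  Mat n m = Vect (Fin n × Fin m)

  col : {n m : ℕ} → Mat n m → Fin m → Vect (Fin n)
  col M j i = M (i , j)

  row : {n m : ℕ} → Mat n m → Fin n → Vect (Fin m)
  row M i j = M (i , j)

  colsp : {n m : ℕ} → Mat n m → Vect (Fin n) → Set (c ⊔ ℓ)
  colsp M = SpanFam (col M)

  rowsp : {n m : ℕ} → Mat n m → Vect (Fin m) → Set (c ⊔ ℓ)
  rowsp M = SpanFam (row M)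

  Tensor : ℕ → ℕ → ℕ → Set c
  Tensor k n m = Fin k → Fin n → Fin m → Carrier

  slice : {k n m : ℕ} → Tensor k n m → Fin k → Mat n m
  slice T a (b , j) = T a b j

  Code : {k n m : ℕ} → Tensor k n m → Mat n m → Set (c ⊔ ℓ)
  Code T = SpanFam (slice T)

  CodeIn : {k n m : ℕ} {p : Level} → Tensor k n m → (Vect (Fin n) → Set p) → Mat n m → Set (c ⊔ ℓ ⊔ p)
  CodeIn T W M = Code T M × (∀ v → colsp M v → W v)

  Nondegenerate : {k n m : ℕ} → Tensor k n m → Set (c ⊔ ℓ)
  Nondegenerate {k} {n} {m} T =
    (∀ (v : Vect (Fin n)) → SpanP (λ w → Σ (Mat n m) λ M → Code T M × colsp M w) v) ×
    (∀ (v : Vect (Fin m)) → SpanP (λ w → Σ (Mat n m) λ M → Code T M × rowsp M w) v)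

  m₂ : {k n m : ℕ} → Vect (Fin n) → Tensor k n m → Mat k m
  m₂ u T (a , j) = sumF (λ b → u b * T a b j)

  ProjReps : {n N : ℕ} → (Fin N → Vect (Fin n)) → Set (c ⊔ ℓ)
  ProjReps {n} {N} u =
    (∀ i → ¬ (u i ≈v zeroV)) ×
    (∀ i j → Σ Carrier (λ a → u i ≈v (a • u j)) → i ≡ j) ×
    (∀ (v : Vect (Fin n)) → ¬ (v ≈v zeroV) → Σ (Fin N) λ i → Σ Carrier λ a → v ≈v (a • u i))

  -- ⟨A⟩ for A = ψ⁻¹(S): span of the representatives u_i, i ∈ S
  SpanReps : {n N : ℕ} → (Fin N → Vect (Fin n)) → Subset N → Vect (Fin n) → Set (c ⊔ ℓ)
  SpanReps {N = N} u S = SpanP (λ v → Σ (Fin N) λ i → (i ∈ S) × (v ≡ u i))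

  -- rows of the block matrix (M_{i_1} ... M_{i_s}) for {i_1..i_s} = S, M_i = m₂(u_i,T);
  -- columns indexed by (i ∈ S , column of M_i)
  blockRow : {k n m N : ℕ} → Tensor k n m → (Fin N → Vect (Fin n)) → (S : Subset N) →
             Fin k → Vect (Σ (Fin N) (λ i → i ∈ S) × Fin m)
  blockRow T u S a ((i , _) , j) = m₂ (u i) T (a , j)

  BlockRowsp : {k n m N : ℕ} → Tensor k n m → (Fin N → Vect (Fin n)) → (S : Subset N) →
               Vect (Σ (Fin N) (λ i → i ∈ S) × Fin m) → Set (c ⊔ ℓ)
  BlockRowsp T u S = SpanFam (blockRow T u S)

{-# OPTIONS --safe #-}
-- With ρ(⟨A⟩) = (k − dim C(⟨A⟩⊥))/m and r(ψ A) = rank (M_{i₁} ⋯ M_{iₛ})/m the claim reads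
-- dim C(⟨A⟩⊥) + rank (M_{i₁} ⋯ M_{iₛ}) = k.  For x ∈ F^k, the dot product of uᵢ with column l of the
-- codeword Σₐ xₐ Tₐ and the entry (i, l) of x (M_{i₁} ⋯ M_{iₛ}) both equal Σ_{a,b} xₐ u_{ib} T_{a,b,l},
-- so the codeword lies in C(⟨A⟩⊥) exactly when x is in the left kernel of the block matrix.  The k
-- slices Tₐ span the k-dimensional C, hence (exchange lemma) form a basis, so x ↦ Σₐ xₐ Tₐ maps that
-- kernel isomorphically onto C(⟨A⟩⊥), and rank–nullity for the rows of the block matrix gives the
-- identity.  Over a finite field both dimensions are computed constructively by sifting the rows:
-- each row either lies in the span of the later ones, contributing a kernel vector, or enlarges that
-- span.  Nothing else about the uᵢ is used.

module Submission where

open import Defs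
open import Level using (Level; _⊔_) renaming (suc to lsuc)
open import Algebra.Bundles using (CommutativeRing)
open import Data.Nat using (ℕ; zero; suc; _≤_; z≤n; s≤s)
import Data.Nat as ℕ
import Data.Nat.Properties as ℕₚ
open import Data.Fin using (Fin; zero; suc; punchIn)
import Data.Fin.Properties as Fin
open import Data.Fin.Subset using (Subset; _∈_)
open import Data.Fin.Subset.Properties using (_∈?_)
open import Data.Vec.Functional using (_∷_; insertAt)
open import Data.Vec.Functional.Properties using (insertAt-lookup; insertAt-punchIn)
open import Data.Vec.Properties.WithK using ([]=-irrelevant)
open import Data.Product using (Σ; _×_; _,_; proj₁; proj₂)
open import Data.Empty using (⊥-elim)
open import Function using (_∘_; flip)
open import Relation.Nullary using (¬_; Dec; yes; no; ¬?)
open import Relation.Nullary.Decidable using (decidable-stable; map′)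
open import Relation.Unary using (Pred) renaming (Decidable to Decidable₁)
open import Relation.Binary.Definitions using (Decidable)
open import Relation.Binary.PropositionalEquality as ≡ using (_≡_)
import Algebra.Properties.Semiring.Sum as SemiringSum
import Algebra.Properties.Ring as RingProperties
import Algebra.Properties.Group as GroupProperties
import Relation.Binary.Reasoning.Setoid as SetoidReasoning

module FiniteSums {c ℓ} (R : CommutativeRing c ℓ) where
  open CommutativeRing R hiding (zero)
  open SemiringSum semiring
    using (sum; sum-cong-≋; sum-cong-≗; sum-replicate-zero; ∑-distrib-+; ∑-comm; *-distribˡ-sum; sum-remove)
  open RingProperties ring using (-1*x≈-x)
  open SetoidReasoning setoid

  private
    variable
      s t : ℕ

  sumF≡sum : (f : Fin s → Carrier) → sumF R f ≡ sum f
  sumF≡sum {zero}  f = ≡.refl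
  sumF≡sum {suc s} f = ≡.cong (f zero +_) (sumF≡sum (f ∘ suc))

  sumF-cong : {f g : Fin s → Carrier} → (∀ j → f j ≈ g j) → sumF R f ≈ sumF R g
  sumF-cong {f = f} {g} f≈g = begin
    sumF R f  ≡⟨ sumF≡sum f ⟩
    sum f     ≈⟨ sum-cong-≋ f≈g ⟩
    sum g     ≡⟨ sumF≡sum g ⟨
    sumF R g  ∎

  sumF-zero : {f : Fin s → Carrier} → (∀ j → f j ≈ 0#) → sumF R f ≈ 0#
  sumF-zero {s} {f} f≈0 = begin
    sumF R f                     ≈⟨ sumF-cong f≈0 ⟩
    sumF R (λ (_ : Fin s) → 0#)  ≡⟨ sumF≡sum (λ (_ : Fin s) → 0#) ⟩
    sum (λ (_ : Fin s) → 0#)     ≈⟨ sum-replicate-zero s ⟩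
    0#                           ∎

  sumF-+ : (f g : Fin s → Carrier) → sumF R (λ j → f j + g j) ≈ sumF R f + sumF R g
  sumF-+ f g = begin
    sumF R (λ j → f j + g j)  ≡⟨ sumF≡sum (λ j → f j + g j) ⟩
    sum (λ j → f j + g j)     ≈⟨ ∑-distrib-+ f g ⟩
    sum f + sum g             ≡⟨ ≡.cong₂ _+_ (sumF≡sum f) (sumF≡sum g) ⟨
    sumF R f + sumF R g       ∎

  *-distribˡ-sumF : ∀ a (f : Fin s → Carrier) → a * sumF R f ≈ sumF R (λ j → a * f j)
  *-distribˡ-sumF a f = begin
    a * sumF R f            ≡⟨ ≡.cong (a *_) (sumF≡sum f) ⟩
    a * sum f               ≈⟨ *-distribˡ-sum a f ⟩
    sum (λ j → a * f j)     ≡⟨ sumF≡sum (λ j → a * f j) ⟨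
    sumF R (λ j → a * f j)  ∎

  *-distribʳ-sumF : ∀ a (f : Fin s → Carrier) → sumF R f * a ≈ sumF R (λ j → f j * a)
  *-distribʳ-sumF a f = begin
    sumF R f * a            ≈⟨ *-comm (sumF R f) a ⟩
    a * sumF R f            ≈⟨ *-distribˡ-sumF a f ⟩
    sumF R (λ j → a * f j)  ≈⟨ sumF-cong (λ j → *-comm a (f j)) ⟩
    sumF R (λ j → f j * a)  ∎

  sumF-comm : (f : Fin s → Fin t → Carrier) →
    sumF R (λ i → sumF R (f i)) ≈ sumF R (λ j → sumF R (λ i → f i j))
  sumF-comm f = begin
    sumF R (λ i → sumF R (f i))          ≡⟨ sumF≡sum² f ⟩
    sum (λ i → sum (f i))                ≈⟨ ∑-comm f ⟩
    sum (λ j → sum (λ i → f i j))        ≡⟨ sumF≡sum² (flip f) ⟨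
    sumF R (λ j → sumF R (λ i → f i j))  ∎
    where
    sumF≡sum² : ∀ {s t} (g : Fin s → Fin t → Carrier) →
      sumF R (λ i → sumF R (g i)) ≡ sum (λ i → sum (g i))
    sumF≡sum² g = ≡.trans (sumF≡sum (λ i → sumF R (g i))) (sum-cong-≗ (sumF≡sum ∘ g))

  sumF-remove : (i : Fin (suc s)) (f : Fin (suc s) → Carrier) → sumF R f ≈ f i + sumF R (f ∘ punchIn i)
  sumF-remove i f = begin
    sumF R f                      ≡⟨ sumF≡sum f ⟩
    sum f                         ≈⟨ sum-remove f ⟩
    f i + sum (f ∘ punchIn i)     ≡⟨ ≡.cong (f i +_) (sumF≡sum (f ∘ punchIn i)) ⟨
    f i + sumF R (f ∘ punchIn i)  ∎

  sumF-neg : (f : Fin s → Carrier) → sumF R (λ j → - f j) ≈ - sumF R f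
  sumF-neg f = begin
    sumF R (λ j → - f j)       ≈⟨ sumF-cong (λ j → -1*x≈-x (f j)) ⟨
    sumF R (λ j → - 1# * f j)  ≈⟨ *-distribˡ-sumF (- 1#) f ⟨
    - 1# * sumF R f            ≈⟨ -1*x≈-x (sumF R f) ⟩
    - sumF R f                 ∎

module LinearCombinations {c ℓ} (R : CommutativeRing c ℓ) where
  open CommutativeRing R hiding (zero)
  open FiniteSums R
  open SetoidReasoning setoid

  private
    variable
      I : Set
      s t : ℕ

  infix 4 _≋_
  _≋_ : Vect R I → Vect R I → Set ℓ
  _≋_ = _≈v_ R

  ≋-sym : {x y : Vect R I} → x ≋ y → y ≋ x
  ≋-sym x≋y i = sym (x≋y i)

  ≋-trans : {x y z : Vect R I} → x ≋ y → y ≋ z → x ≋ z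
  ≋-trans x≋y y≋z i = trans (x≋y i) (y≋z i)

  lincomb-cong : {cs ds : Fin s → Carrier} {w w′ : Fin s → Vect R I} →
    (∀ j → cs j ≈ ds j) → (∀ j → w j ≋ w′ j) → lincomb R cs w ≋ lincomb R ds w′
  lincomb-cong cs≈ds w≋w′ i = sumF-cong (λ j → *-cong (cs≈ds j) (w≋w′ j i))

  lincomb-*ˡ : (μ : Carrier) (cs : Fin s → Carrier) (w : Fin s → Vect R I) (i : I) →
    μ * lincomb R cs w i ≈ lincomb R (λ j → μ * cs j) w i
  lincomb-*ˡ μ cs w i =
    trans (*-distribˡ-sumF μ (λ j → cs j * w j i)) (sumF-cong (λ j → sym (*-assoc μ (cs j) (w j i))))

  lincomb-+-* : (cs ds : Fin s → Carrier) (μ : Carrier) (w : Fin s → Vect R I) (i : I) →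
    lincomb R cs w i + μ * lincomb R ds w i ≈ lincomb R (λ j → cs j + μ * ds j) w i
  lincomb-+-* cs ds μ w i = begin
    sumF R (λ j → cs j * w j i) + μ * sumF R (λ j → ds j * w j i)
      ≈⟨ +-congˡ (*-distribˡ-sumF μ (λ j → ds j * w j i)) ⟩
    sumF R (λ j → cs j * w j i) + sumF R (λ j → μ * (ds j * w j i))
      ≈⟨ sumF-+ (λ j → cs j * w j i) (λ j → μ * (ds j * w j i)) ⟨
    sumF R (λ j → cs j * w j i + μ * (ds j * w j i))
      ≈⟨ sumF-cong (λ j → trans (+-congˡ (sym (*-assoc μ (ds j) (w j i))))
                                (sym (distribʳ (w j i) (cs j) (μ * ds j)))) ⟩
    sumF R (λ j → (cs j + μ * ds j) * w j i) ∎

  lincomb-lincomb : (cs : Fin s → Carrier) (D : Fin s → Fin t → Carrier) (w : Fin t → Vect R I) →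
    lincomb R cs (λ j → lincomb R (D j) w) ≋ lincomb R (λ a → sumF R (λ j → cs j * D j a)) w
  lincomb-lincomb cs D w i = begin
    sumF R (λ j → cs j * sumF R (λ a → D j a * w a i))
      ≈⟨ sumF-cong (λ j → *-distribˡ-sumF (cs j) (λ a → D j a * w a i)) ⟩
    sumF R (λ j → sumF R (λ a → cs j * (D j a * w a i)))
      ≈⟨ sumF-comm (λ j a → cs j * (D j a * w a i)) ⟩
    sumF R (λ a → sumF R (λ j → cs j * (D j a * w a i)))
      ≈⟨ sumF-cong (λ a → sumF-cong (λ j → sym (*-assoc (cs j) (D j a) (w a i)))) ⟩
    sumF R (λ a → sumF R (λ j → cs j * D j a * w a i))
      ≈⟨ sumF-cong (λ a → *-distribʳ-sumF (w a i) (λ j → cs j * D j a)) ⟨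
    sumF R (λ a → sumF R (λ j → cs j * D j a) * w a i) ∎

  lincomb-head≈0 : (cs : Fin (suc s) → Carrier) (w : Fin (suc s) → Vect R I) →
    cs zero ≈ 0# → lincomb R cs w ≋ lincomb R (cs ∘ suc) (w ∘ suc)
  lincomb-head≈0 cs w cs₀≈0 i =
    trans (+-congʳ (trans (*-congʳ cs₀≈0) (zeroˡ (w zero i)))) (+-identityˡ _)

  unitVec : Fin s → Fin s → Carrier
  unitVec zero    = 1# ∷ λ _ → 0#
  unitVec (suc l) = 0# ∷ unitVec l

  unitVec-diag : (l : Fin s) → unitVec l l ≡ 1#
  unitVec-diag zero    = ≡.refl
  unitVec-diag (suc l) = unitVec-diag l

  lincomb-unitVec : (l : Fin s) (w : Fin s → Vect R I) → lincomb R (unitVec l) w ≋ w l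
  lincomb-unitVec zero w i =
    trans (+-cong (*-identityˡ (w zero i)) (sumF-zero (λ j → zeroˡ (w (suc j) i)))) (+-identityʳ (w zero i))
  lincomb-unitVec (suc l) w i =
    trans (+-cong (zeroˡ (w zero i)) (lincomb-unitVec l (w ∘ suc) i)) (+-identityˡ (w (suc l) i))

  generator∈span : (w : Fin s → Vect R I) (l : Fin s) → SpanFam R w (w l)
  generator∈span w l = unitVec l , ≋-sym (lincomb-unitVec l w)

  span-trans : {v : Fin s → Vect R I} {w : Fin t → Vect R I} →
    (∀ j → SpanFam R w (v j)) → ∀ {x} → SpanFam R v x → SpanFam R w x
  span-trans {w = w} v∈⟨w⟩ (cs , x≋) =
    (λ a → sumF R (λ j → cs j * D j a)) ,
    ≋-trans x≋ (≋-trans (lincomb-cong (λ _ → refl) (proj₂ ∘ v∈⟨w⟩)) (lincomb-lincomb cs D w))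
    where
    D = proj₁ ∘ v∈⟨w⟩

  span-cong : {w w′ : Fin s → Vect R I} → (∀ j → w j ≋ w′ j) →
    ∀ {x} → SpanFam R w x → SpanFam R w′ x
  span-cong w≋w′ (cs , x≋) = cs , ≋-trans x≋ (lincomb-cong (λ _ → refl) w≋w′)

  span-∷ : {v : Vect R I} {rs : Fin s → Vect R I} {x : Vect R I} → SpanFam R rs x → SpanFam R (v ∷ rs) x
  span-∷ {v = v} (cs , x≋) =
    0# ∷ cs , λ i → trans (x≋ i) (sym (trans (+-congʳ (zeroˡ (v i))) (+-identityˡ _)))

  span-tail : {w : Fin (suc s) → Vect R I} {cs : Fin (suc s) → Carrier} {x : Vect R I} →
    cs zero ≈ 0# → x ≋ lincomb R cs w → SpanFam R (w ∘ suc) x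
  span-tail {w = w} {cs} cs₀≈0 x≋ = cs ∘ suc , ≋-trans x≋ (lincomb-head≈0 cs w cs₀≈0)

  Kernel : (Fin s → Vect R I) → Vect R (Fin s) → Set ℓ
  Kernel w x = lincomb R x w ≋ zeroV R

  Kernel-tail : {w : Fin (suc s) → Vect R I} {x : Vect R (Fin (suc s))} →
    x zero ≈ 0# → Kernel w x → Kernel (w ∘ suc) (x ∘ suc)
  Kernel-tail {w = w} {x} x₀≈0 x∈ker = ≋-trans (≋-sym (lincomb-head≈0 x w x₀≈0)) x∈ker

  Kernel-cons-zero : {v : Vect R I} {rs : Fin s → Vect R I} {y : Vect R (Fin s)} →
    Kernel rs y → Kernel (v ∷ rs) (0# ∷ y)
  Kernel-cons-zero {v = v} {rs} {y} y∈ker = ≋-trans (lincomb-head≈0 (0# ∷ y) (v ∷ rs) refl) y∈ker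

module DotProduct {c ℓ} (R : CommutativeRing c ℓ) where
  open CommutativeRing R hiding (zero)
  open FiniteSums R
  open LinearCombinations R
  open SetoidReasoning setoid

  private
    variable
      n t : ℕ

  dot-cong : {w w′ v v′ : Vect R (Fin n)} → w ≋ w′ → v ≋ v′ → dot R w v ≈ dot R w′ v′
  dot-cong w≋ v≋ = sumF-cong (λ b → *-cong (w≋ b) (v≋ b))

  dot-comm : (w v : Vect R (Fin n)) → dot R w v ≈ dot R v w
  dot-comm w v = sumF-cong (λ b → *-comm (w b) (v b))

  dot-lincombˡ : (ds : Fin t → Carrier) (ws : Fin t → Vect R (Fin n)) (z : Vect R (Fin n)) →
    dot R (lincomb R ds ws) z ≈ sumF R (λ a → ds a * dot R (ws a) z)
  dot-lincombˡ ds ws z = begin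
    sumF R (λ b → sumF R (λ a → ds a * ws a b) * z b)
      ≈⟨ sumF-cong (λ b → *-distribʳ-sumF (z b) (λ a → ds a * ws a b)) ⟩
    sumF R (λ b → sumF R (λ a → ds a * ws a b * z b))
      ≈⟨ sumF-comm (λ b a → ds a * ws a b * z b) ⟩
    sumF R (λ a → sumF R (λ b → ds a * ws a b * z b))
      ≈⟨ sumF-cong (λ a → sumF-cong (λ b → *-assoc (ds a) (ws a b) (z b))) ⟩
    sumF R (λ a → sumF R (λ b → ds a * (ws a b * z b)))
      ≈⟨ sumF-cong (λ a → *-distribˡ-sumF (ds a) (λ b → ws a b * z b)) ⟨
    sumF R (λ a → ds a * dot R (ws a) z) ∎

  dot-lincombʳ : (z : Vect R (Fin n)) (cs : Fin t → Carrier) (vs : Fin t → Vect R (Fin n)) →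
    dot R z (lincomb R cs vs) ≈ sumF R (λ a → cs a * dot R z (vs a))
  dot-lincombʳ z cs vs = begin
    dot R z (lincomb R cs vs)             ≈⟨ dot-comm z (lincomb R cs vs) ⟩
    dot R (lincomb R cs vs) z             ≈⟨ dot-lincombˡ cs vs z ⟩
    sumF R (λ a → cs a * dot R (vs a) z)  ≈⟨ sumF-cong (λ a → *-congˡ (dot-comm (vs a) z)) ⟩
    sumF R (λ a → cs a * dot R z (vs a))  ∎

  span-orthogonal : {p : Level} {P : Vect R (Fin n) → Set p} {vs : Fin t → Vect R (Fin n)} →
    (∀ {w} → P w → ∀ l → dot R w (vs l) ≈ 0#) →
    ∀ {w v} → SpanP R P w → SpanFam R vs v → dot R w v ≈ 0#
  span-orthogonal {vs = vs} P⊥vs {w} {v} (_ , ws , ws∈P , ds , w≋) (cs , v≋) = begin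
    dot R w v
      ≈⟨ dot-cong w≋ v≋ ⟩
    dot R (lincomb R ds ws) (lincomb R cs vs)
      ≈⟨ dot-lincombˡ ds ws (lincomb R cs vs) ⟩
    sumF R (λ a → ds a * dot R (ws a) (lincomb R cs vs))
      ≈⟨ sumF-zero (λ a → trans (*-congˡ (ws⊥v a)) (zeroʳ (ds a))) ⟩
    0# ∎
    where
    ws⊥v : ∀ a → dot R (ws a) (lincomb R cs vs) ≈ 0#
    ws⊥v a = trans (dot-lincombʳ (ws a) cs vs)
                   (sumF-zero (λ l → trans (*-congˡ (P⊥vs (ws∈P a) l)) (zeroʳ (cs l))))

module Dimension {c ℓ} (R : CommutativeRing c ℓ) where
  open CommutativeRing R hiding (zero)
  open FiniteSums R
  open LinearCombinations R
  open RingProperties ring using (-‿distribˡ-*; -‿distribʳ-*)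
  open GroupProperties +-group using (//-rightDividesʳ)
  open SetoidReasoning setoid

  private
    variable
      I : Set
      s d e : ℕ

  IsDim-image : {p p′ : Level} {Q : Vect R (Fin s) → Set p} {P : Vect R I → Set p′} {w : Fin s → Vect R I} →
    LinIndep R w → IsDim R Q d →
    (∀ {x} → Q x → P (lincomb R x w)) →
    (∀ {M} → P M → Σ (Vect R (Fin s)) λ x → Q x × M ≋ lincomb R x w) →
    IsDim R P d
  IsDim-image {P = P} {w = w} w-indep (b , b∈Q , b-indep , b-spans) Q⇒P P⇒Q =
    (λ j → lincomb R (b j) w) , (λ j → Q⇒P (b∈Q j)) , image-indep , image-spans
    where
    image-indep : LinIndep R (λ j → lincomb R (b j) w)
    image-indep β β∈ker =
      b-indep β (w-indep (lincomb R β b) (≋-trans (≋-sym (lincomb-lincomb β b w)) β∈ker))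
    image-spans : ∀ M → P M → SpanFam R (λ j → lincomb R (b j) w) M
    image-spans M M∈P with P⇒Q M∈P
    ... | x , x∈Q , M≋ with b-spans x x∈Q
    ... | β , x≋ =
      β , ≋-trans M≋ (≋-trans (lincomb-cong x≋ (λ _ _ → refl)) (≋-sym (lincomb-lincomb β b w)))

  LinIndep-eliminate : {v : Fin (suc s) → Vect R I} → LinIndep R v →
    (j₀ : Fin (suc s)) (μ : Fin s → Carrier) → LinIndep R (λ i x → v (punchIn j₀ i) x + μ i * v j₀ x)
  LinIndep-eliminate {v = v} v-indep j₀ μ β β∈ker i =
    trans (reflexive (≡.sym (insertAt-punchIn β j₀ σ i))) (v-indep cs cs∈ker (punchIn j₀ i))
    where
    σ  = sumF R (λ i → β i * μ i)
    cs = insertAt β j₀ σ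
    cs∈ker : Kernel v cs
    cs∈ker x = begin
      sumF R (λ j → cs j * v j x)
        ≈⟨ sumF-remove j₀ (λ j → cs j * v j x) ⟩
      cs j₀ * v j₀ x + sumF R (λ i → cs (punchIn j₀ i) * v (punchIn j₀ i) x)
        ≈⟨ +-cong (*-congʳ (reflexive (insertAt-lookup β j₀ σ)))
                  (sumF-cong (λ i → *-congʳ (reflexive (insertAt-punchIn β j₀ σ i)))) ⟩
      σ * v j₀ x + sumF R (λ i → β i * v (punchIn j₀ i) x)
        ≈⟨ +-comm _ _ ⟩
      sumF R (λ i → β i * v (punchIn j₀ i) x) + σ * v j₀ x
        ≈⟨ +-congˡ (*-distribʳ-sumF (v j₀ x) (λ i → β i * μ i)) ⟩
      sumF R (λ i → β i * v (punchIn j₀ i) x) + sumF R (λ i → β i * μ i * v j₀ x)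
        ≈⟨ sumF-+ (λ i → β i * v (punchIn j₀ i) x) (λ i → β i * μ i * v j₀ x) ⟨
      sumF R (λ i → β i * v (punchIn j₀ i) x + β i * μ i * v j₀ x)
        ≈⟨ sumF-cong (λ i → trans (+-congˡ (*-assoc (β i) (μ i) (v j₀ x))) (sym (distribˡ (β i) _ _))) ⟩
      sumF R (λ i → β i * (v (punchIn j₀ i) x + μ i * v j₀ x))
        ≈⟨ β∈ker x ⟩
      0# ∎

  span-dim-∷-redundant : {v : Vect R I} {rs : Fin s → Vect R I} →
    SpanFam R rs v → IsDim R (SpanFam R rs) e → IsDim R (SpanFam R (v ∷ rs)) e
  span-dim-∷-redundant {v = v} {rs} v∈⟨rs⟩ (b , b∈ , b-indep , b-spans) =
    b , span-∷ ∘ b∈ , b-indep , λ x x∈ → b-spans x (span-trans generators∈⟨rs⟩ x∈)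
    where
    generators∈⟨rs⟩ : ∀ j → SpanFam R rs ((v ∷ rs) j)
    generators∈⟨rs⟩ zero    = v∈⟨rs⟩
    generators∈⟨rs⟩ (suc j) = generator∈span rs j

  kernel-dim-∷-redundant : {v : Vect R I} {rs : Fin s → Vect R I} (cf : Fin s → Carrier) →
    v ≋ lincomb R cf rs → IsDim R (Kernel rs) d → IsDim R (Kernel (v ∷ rs)) (suc d)
  kernel-dim-∷-redundant {s = s} {d = d} {v = v} {rs} cf v≋ (kb , kb∈ , kb-indep , kb-spans) =
    basis , members , indep , spans
    where
    basis : Fin (suc d) → Vect R (Fin (suc s))
    basis = (1# ∷ (-_ ∘ cf)) ∷ (λ j → 0# ∷ kb j)

    basis-head : ∀ β → lincomb R β basis zero ≈ β zero
    basis-head β = trans (+-cong (*-identityʳ (β zero)) (sumF-zero (λ j → zeroʳ (β (suc j))))) (+-identityʳ _)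

    members : ∀ j → Kernel (v ∷ rs) (basis j)
    members zero i = begin
      1# * v i + sumF R (λ a → - cf a * rs a i)
        ≈⟨ +-cong (trans (*-identityˡ (v i)) (v≋ i))
                  (sumF-cong (λ a → sym (-‿distribˡ-* (cf a) (rs a i)))) ⟩
      lincomb R cf rs i + sumF R (λ a → - (cf a * rs a i))
        ≈⟨ +-congˡ (sumF-neg (λ a → cf a * rs a i)) ⟩
      lincomb R cf rs i - lincomb R cf rs i
        ≈⟨ -‿inverseʳ _ ⟩
      0# ∎
    members (suc j) = Kernel-cons-zero {v = v} {rs} {kb j} (kb∈ j)

    indep : LinIndep R basis
    indep β β∈ker zero    = trans (sym (basis-head β)) (β∈ker zero)
    indep β β∈ker (suc j) =
      kb-indep (β ∘ suc) (λ a → Kernel-tail {w = basis} {β} (indep β β∈ker zero) β∈ker (suc a)) j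

    spans : ∀ x → Kernel (v ∷ rs) x → SpanFam R basis x
    spans x x∈ker = x zero ∷ γ , λ { zero → sym (basis-head (x zero ∷ γ)) ; (suc a) → tail≈ a }
      where
      y : Vect R (Fin s)
      y a = x (suc a) + x zero * cf a
      y∈ker : Kernel rs y
      y∈ker i = begin
        lincomb R y rs i                                       ≈⟨ lincomb-+-* (x ∘ suc) cf (x zero) rs i ⟨
        lincomb R (x ∘ suc) rs i + x zero * lincomb R cf rs i  ≈⟨ +-congˡ (*-congˡ (v≋ i)) ⟨
        lincomb R (x ∘ suc) rs i + x zero * v i                ≈⟨ +-comm _ _ ⟩
        lincomb R x (v ∷ rs) i                                 ≈⟨ x∈ker i ⟩
        0#                                                     ∎
      γ = proj₁ (kb-spans y y∈ker)
      tail≈ : ∀ a → x (suc a) ≈ lincomb R (x zero ∷ γ) basis (suc a)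
      tail≈ a = begin
        x (suc a)                             ≈⟨ //-rightDividesʳ (x zero * cf a) (x (suc a)) ⟨
        y a - x zero * cf a                   ≈⟨ +-congʳ (proj₂ (kb-spans y y∈ker) a) ⟩
        lincomb R γ kb a - x zero * cf a      ≈⟨ +-comm _ _ ⟩
        - (x zero * cf a) + lincomb R γ kb a  ≈⟨ +-congʳ (-‿distribʳ-* (x zero) (cf a)) ⟩
        x zero * - cf a + lincomb R γ kb a    ∎

module Steinitz {c ℓ} (F : CommutativeRing c ℓ) (isField : IsField F)
                (_≟_ : Decidable (CommutativeRing._≈_ F)) where
  open CommutativeRing F hiding (zero)
  open LinearCombinations F
  open Dimension F
  open RingProperties ring using (-‿distribˡ-*)
  open SetoidReasoning setoid

  private
    variable
      I : Set
      a e : ℕ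

  LinIndep-nonzero : {v : Fin a → Vect F I} → LinIndep F v → ∀ j → ¬ v j ≋ zeroV F
  LinIndep-nonzero {v = v} v-indep j v≋0 = proj₁ isField (begin
    1#           ≡⟨ unitVec-diag j ⟨
    unitVec j j  ≈⟨ v-indep (unitVec j) (≋-trans (lincomb-unitVec j v) v≋0) j ⟩
    0#           ∎)

  eliminate-pivot : ∀ x {p p⁻¹} → p * p⁻¹ ≈ 1# → x + - (x * p⁻¹) * p ≈ 0#
  eliminate-pivot x {p} {p⁻¹} pp⁻¹≈1 = begin
    x + - (x * p⁻¹) * p    ≈⟨ +-congˡ (-‿distribˡ-* (x * p⁻¹) p) ⟨
    x + - (x * p⁻¹ * p)    ≈⟨ +-congˡ (-‿cong (*-assoc x p⁻¹ p)) ⟩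
    x + - (x * (p⁻¹ * p))  ≈⟨ +-congˡ (-‿cong (*-congˡ (trans (*-comm p⁻¹ p) pp⁻¹≈1))) ⟩
    x + - (x * 1#)         ≈⟨ +-congˡ (-‿cong (*-identityʳ x)) ⟩
    x + - x                ≈⟨ -‿inverseʳ x ⟩
    0#                     ∎

  -- If some v j has a nonzero w-zero coefficient, use it as a pivot to clear that coefficient from
  -- the other vectors; either way a − 1 or a independent vectors land in the span of w ∘ suc.
  LinIndep-length≤ : {v : Fin a → Vect F I} {w : Fin e → Vect F I} →
    LinIndep F v → (∀ j → SpanFam F w (v j)) → a ≤ e
  LinIndep-length≤ {a = zero} _ _ = z≤n
  LinIndep-length≤ {a = suc a} {e = zero} {v = v} v-indep v∈⟨w⟩ =
    ⊥-elim (LinIndep-nonzero {v = v} v-indep zero (proj₂ (v∈⟨w⟩ zero)))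
  LinIndep-length≤ {a = suc a} {e = suc e} {v = v} {w} v-indep v∈⟨w⟩
    with Fin.any? (λ j → ¬? (proj₁ (v∈⟨w⟩ j) zero ≟ 0#))
  ... | no no-pivot = ℕₚ.m≤n⇒m≤1+n (LinIndep-length≤ {v = v} {w ∘ suc} v-indep v∈⟨tail⟩)
    where
    v∈⟨tail⟩ : ∀ j → SpanFam F (w ∘ suc) (v j)
    v∈⟨tail⟩ j = span-tail {w = w} {proj₁ (v∈⟨w⟩ j)}
      (decidable-stable (proj₁ (v∈⟨w⟩ j) zero ≟ 0#) (λ ≉0 → no-pivot (j , ≉0)))
      (proj₂ (v∈⟨w⟩ j))
  ... | yes (j₀ , p≉0) =
    s≤s (LinIndep-length≤ {w = w ∘ suc} (LinIndep-eliminate {v = v} v-indep j₀ μ) v′∈⟨tail⟩)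
    where
    C = proj₁ ∘ v∈⟨w⟩
    p⁻¹ = proj₁ (proj₂ isField (C j₀ zero) p≉0)
    μ : Fin a → Carrier
    μ i = - (C (punchIn j₀ i) zero * p⁻¹)
    v′∈⟨tail⟩ : ∀ i → SpanFam F (w ∘ suc) (λ x → v (punchIn j₀ i) x + μ i * v j₀ x)
    v′∈⟨tail⟩ i = span-tail {w = w} {λ t → C (punchIn j₀ i) t + μ i * C j₀ t}
      (eliminate-pivot (C (punchIn j₀ i) zero) (proj₂ (proj₂ isField (C j₀ zero) p≉0)))
      (λ x → trans (+-cong (proj₂ (v∈⟨w⟩ (punchIn j₀ i)) x) (*-congˡ (proj₂ (v∈⟨w⟩ j₀) x)))
                   (lincomb-+-* (C (punchIn j₀ i)) (C j₀) (μ i) w x))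

Searchable : (ℓ : Level) → Set → Set (lsuc ℓ)
Searchable ℓ I = {P : Pred I ℓ} → Decidable₁ P → Dec (∀ x → P x)

Searchable-Fin : ∀ {ℓ n} → Searchable ℓ (Fin n)
Searchable-Fin = Fin.all?

Searchable-× : ∀ {ℓ} {A B : Set} → Searchable ℓ A → Searchable ℓ B → Searchable ℓ (A × B)
Searchable-× A-search B-search P? =
  map′ (λ ∀∀P (a , b) → ∀∀P a b) (λ ∀P a b → ∀P (a , b))
       (A-search (λ a → B-search (λ b → P? (a , b))))

Searchable-subset : ∀ {ℓ N} (S : Subset N) → Searchable ℓ (Σ (Fin N) (_∈ S))
Searchable-subset S {P} P? =
  map′ (λ ∀P (i , i∈S) → ∀P i i∈S) (λ ∀P i i∈S → ∀P (i , i∈S)) (Fin.all? P-on-member?)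
  where
  P-on-member? : ∀ i → Dec (∀ i∈S → P (i , i∈S))
  P-on-member? i with i ∈? S
  ... | no i∉S = yes (λ i∈S → ⊥-elim (i∉S i∈S))
  ... | yes i∈S with P? (i , i∈S)
  ...   | yes Pi = yes (λ i∈S′ → ≡.subst (λ m → P (i , m)) ([]=-irrelevant i∈S i∈S′) Pi)
  ...   | no ¬Pi = no (λ ∀P → ¬Pi (∀P i∈S))

HasCard⇒decidable : ∀ {c ℓ} (R : CommutativeRing c ℓ) {q : ℕ} →
  HasCard R q → Decidable (CommutativeRing._≈_ R)
HasCard⇒decidable R (enum , enum-injective , enum-surjective) x y
  with proj₁ (enum-surjective x) Fin.≟ proj₁ (enum-surjective y)
... | yes i≡j = yes (trans (proj₂ (enum-surjective x))
                      (trans (reflexive (≡.cong enum i≡j)) (sym (proj₂ (enum-surjective y)))))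
  where open CommutativeRing R
... | no i≢j = no (λ x≈y → i≢j (enum-injective _ _
                      (trans (sym (proj₂ (enum-surjective x))) (trans x≈y (proj₂ (enum-surjective y))))))
  where open CommutativeRing R

module FiniteField {c ℓ} (F : CommutativeRing c ℓ) (isField : IsField F) {q : ℕ} (card : HasCard F q) where
  open CommutativeRing F hiding (zero)
  open FiniteSums F
  open LinearCombinations F
  open Dimension F
  open Steinitz F isField (HasCard⇒decidable F card)
  open RingProperties ring using (-‿distribˡ-*; -‿distribʳ-*)
  open GroupProperties +-group using (//-rightDividesˡ; //-rightDividesʳ; inverseˡ-unique)
  open SetoidReasoning setoid

  private
    variable
      I : Set
      s d e : ℕ
    _≟_ = HasCard⇒decidable F card
    enum = proj₁ card
    enum-surjective = proj₂ (proj₂ card)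

  ≋-dec : Searchable ℓ I → Decidable (_≋_ {I})
  ≋-dec I-search x y = I-search (λ i → x i ≟ y i)

  span-dec : Searchable ℓ I → (w : Fin s → Vect F I) → Decidable₁ (SpanFam F w)
  span-dec {s = zero} I-search w x = map′ ((λ ()) ,_) proj₂ (≋-dec I-search x (zeroV F))
  span-dec {s = suc s} I-search w x
    with Fin.any? (λ k → span-dec I-search (w ∘ suc) (λ i → x i - enum k * w zero i))
  ... | yes (k , cs , x-kw₀≋) = yes (enum k ∷ cs , λ i → begin
    x i                                            ≈⟨ //-rightDividesˡ (enum k * w zero i) (x i) ⟨
    (x i - enum k * w zero i) + enum k * w zero i  ≈⟨ +-congʳ (x-kw₀≋ i) ⟩
    lincomb F cs (w ∘ suc) i + enum k * w zero i   ≈⟨ +-comm _ _ ⟩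
    enum k * w zero i + lincomb F cs (w ∘ suc) i   ∎)
  ... | no ∄k = no λ (cs , x≋) → ∄k (index (cs zero) , cs ∘ suc , λ i → begin
    x i - enum (index (cs zero)) * w zero i
      ≈⟨ +-congˡ (-‿cong (*-congʳ (proj₂ (enum-surjective (cs zero))))) ⟨
    x i - cs zero * w zero i
      ≈⟨ +-congʳ (trans (x≋ i) (+-comm _ _)) ⟩
    (lincomb F (cs ∘ suc) (w ∘ suc) i + cs zero * w zero i) - cs zero * w zero i
      ≈⟨ //-rightDividesʳ (cs zero * w zero i) _ ⟩
    lincomb F (cs ∘ suc) (w ∘ suc) i ∎)
    where index = proj₁ ∘ enum-surjective

  Kernel-head≉0⇒span : {v : Vect F I} {rs : Fin s → Vect F I} {x : Vect F (Fin (suc s))} →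
    Kernel (v ∷ rs) x → ¬ x zero ≈ 0# → SpanFam F rs v
  Kernel-head≉0⇒span {v = v} {rs} {x} x∈ker x₀≉0 = (λ a → - x₀⁻¹ * x (suc a)) , λ i → begin
    v i                                        ≈⟨ *-identityˡ (v i) ⟨
    1# * v i                                   ≈⟨ *-congʳ (trans (*-comm x₀⁻¹ (x zero)) x₀x₀⁻¹≈1) ⟨
    x₀⁻¹ * x zero * v i                        ≈⟨ *-assoc x₀⁻¹ (x zero) (v i) ⟩
    x₀⁻¹ * (x zero * v i)                      ≈⟨ *-congˡ (inverseˡ-unique _ _ (x∈ker i)) ⟩
    x₀⁻¹ * - lincomb F (x ∘ suc) rs i          ≈⟨ -‿distribʳ-* x₀⁻¹ _ ⟨
    - (x₀⁻¹ * lincomb F (x ∘ suc) rs i)        ≈⟨ -‿distribˡ-* x₀⁻¹ _ ⟩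
    - x₀⁻¹ * lincomb F (x ∘ suc) rs i          ≈⟨ lincomb-*ˡ (- x₀⁻¹) (x ∘ suc) rs i ⟩
    lincomb F (λ a → - x₀⁻¹ * x (suc a)) rs i  ∎
    where
    x₀⁻¹ = proj₁ (proj₂ isField (x zero) x₀≉0)
    x₀x₀⁻¹≈1 = proj₂ (proj₂ isField (x zero) x₀≉0)

  Kernel-head≈0 : {v : Vect F I} {rs : Fin s → Vect F I} {x : Vect F (Fin (suc s))} →
    ¬ SpanFam F rs v → Kernel (v ∷ rs) x → x zero ≈ 0#
  Kernel-head≈0 {v = v} {rs} {x} v∉⟨rs⟩ x∈ker =
    decidable-stable (x zero ≟ 0#) (v∉⟨rs⟩ ∘ Kernel-head≉0⇒span {v = v} {rs} {x} x∈ker)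

  span-dim-∷-new : {v : Vect F I} {rs : Fin s → Vect F I} →
    ¬ SpanFam F rs v → IsDim F (SpanFam F rs) e → IsDim F (SpanFam F (v ∷ rs)) (suc e)
  span-dim-∷-new {v = v} {rs} v∉⟨rs⟩ (b , b∈ , b-indep , b-spans) = v ∷ b , members , indep , spans
    where
    members : ∀ j → SpanFam F (v ∷ rs) ((v ∷ b) j)
    members zero    = generator∈span (v ∷ rs) zero
    members (suc j) = span-∷ (b∈ j)

    indep : LinIndep F (v ∷ b)
    indep β β∈ker zero    = Kernel-head≈0 {x = β} (v∉⟨rs⟩ ∘ span-trans b∈) β∈ker
    indep β β∈ker (suc j) =
      b-indep (β ∘ suc) (Kernel-tail {w = v ∷ b} {β} (indep β β∈ker zero) β∈ker) j

    spans : ∀ x → SpanFam F (v ∷ rs) x → SpanFam F (v ∷ b) x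
    spans x (cs , x≋) =
      cs zero ∷ proj₁ tail∈⟨b⟩ , λ i → trans (x≋ i) (+-congˡ (proj₂ tail∈⟨b⟩ i))
      where
      tail∈⟨b⟩ = b-spans (lincomb F (cs ∘ suc) rs) (cs ∘ suc , λ _ → refl)

  kernel-dim-∷-new : {v : Vect F I} {rs : Fin s → Vect F I} →
    ¬ SpanFam F rs v → IsDim F (Kernel rs) d → IsDim F (Kernel (v ∷ rs)) d
  kernel-dim-∷-new {v = v} {rs} v∉⟨rs⟩ (kb , kb∈ , kb-indep , kb-spans) =
    (λ j → 0# ∷ kb j) , (λ j → Kernel-cons-zero {v = v} {rs} {kb j} (kb∈ j)) ,
    (λ β β∈ker → kb-indep β (β∈ker ∘ suc)) , spans
    where
    spans : ∀ x → Kernel (v ∷ rs) x → SpanFam F (λ j → 0# ∷ kb j) x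
    spans x x∈ker = γ , λ { zero    → trans x₀≈0 (sym (sumF-zero (λ j → zeroʳ (γ j))))
                          ; (suc a) → proj₂ tail∈⟨kb⟩ a }
      where
      x₀≈0 = Kernel-head≈0 {x = x} v∉⟨rs⟩ x∈ker
      tail∈⟨kb⟩ = kb-spans (x ∘ suc) (Kernel-tail {w = v ∷ rs} {x} x₀≈0 x∈ker)
      γ = proj₁ tail∈⟨kb⟩

  record RankNullity {I : Set} {s : ℕ} (r : Fin s → Vect F I) : Set (c ⊔ ℓ) where
    field
      nullity rank : ℕ
      kernel-dim   : IsDim F (Kernel r) nullity
      span-dim     : IsDim F (SpanFam F r) rank
      nullity+rank : nullity ℕ.+ rank ≡ s

  rank-nullity : Searchable ℓ I → (r : Fin s → Vect F I) → RankNullity r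
  rank-nullity {s = zero} _ r = record
    { nullity      = 0
    ; rank         = 0
    ; kernel-dim   = (λ ()) , (λ ()) , (λ _ _ ()) , (λ _ _ → (λ ()) , λ ())
    ; span-dim     = (λ ()) , (λ ()) , (λ _ _ ()) , (λ _ x∈span → x∈span)
    ; nullity+rank = ≡.refl
    }
  rank-nullity {s = suc s} I-search r with span-dec I-search (r ∘ suc) (r zero)
  ... | yes r₀∈@(cf , r₀≋) = record
    { nullity      = suc nullity
    ; rank         = rank
    ; kernel-dim   = kernel-dim-∷-redundant cf r₀≋ kernel-dim
    ; span-dim     = span-dim-∷-redundant r₀∈ span-dim
    ; nullity+rank = ≡.cong suc nullity+rank
    }
    where open RankNullity (rank-nullity I-search (r ∘ suc))
  ... | no r₀∉ = record
    { nullity      = nullity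
    ; rank         = suc rank
    ; kernel-dim   = kernel-dim-∷-new r₀∉ kernel-dim
    ; span-dim     = span-dim-∷-new r₀∉ span-dim
    ; nullity+rank = ≡.trans (ℕₚ.+-suc nullity rank) (≡.cong suc nullity+rank)
    }
    where open RankNullity (rank-nullity I-search (r ∘ suc))

  dim-span⇒LinIndep : Searchable ℓ I → {w : Fin s → Vect F I} → IsDim F (SpanFam F w) s → LinIndep F w
  dim-span⇒LinIndep I-search {w} (b , b∈ , b-indep , _) with rank-nullity I-search w
  ... | record { nullity = zero ; kernel-dim = _ , _ , _ , kb-spans } =
    λ x x∈ker → proj₂ (kb-spans x x∈ker)
  ... | record { nullity = suc d ; rank = e ; span-dim = _ , _ , _ , sb-spans ; nullity+rank = d+e≡s } =
    ⊥-elim (ℕₚ.m+1+n≰m e (≡.subst (ℕ._≤ e) (≡.sym (≡.trans (ℕₚ.+-comm e (suc d)) d+e≡s)) s≤e))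
    where
    s≤e = LinIndep-length≤ b-indep (λ j → sb-spans (b j) (b∈ j))

module TensorCodes {c ℓ} (R : CommutativeRing c ℓ) {k n m : ℕ} (T : Tensor R k n m) where
  open CommutativeRing R hiding (zero)
  open LinearCombinations R
  open DotProduct R
  open Dimension R

  codeword : Vect R (Fin k) → Mat R n m
  codeword x = lincomb R x (slice R T)

  dot-col-codeword : (w : Vect R (Fin n)) (x : Vect R (Fin k)) (l : Fin m) →
    dot R w (col R (codeword x) l) ≈ sumF R (λ a → x a * m₂ R w T (a , l))
  dot-col-codeword w x l = dot-lincombʳ w x (λ a → col R (slice R T a) l)

  module _ {N : ℕ} (u : Fin N → Vect R (Fin n)) (S : Subset N) where

    kernel⇒colsp-perp : {x : Vect R (Fin k)} → Kernel (blockRow R T u S) x →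
      ∀ v → colsp R (codeword x) v → Perp R (SpanReps R u S) v
    kernel⇒colsp-perp {x} x∈ker v v∈colsp w w∈⟨u⟩ = span-orthogonal reps⊥cols w∈⟨u⟩ v∈colsp
      where
      reps⊥cols : ∀ {w} → Σ (Fin N) (λ i → (i ∈ S) × (w ≡ u i)) →
        ∀ l → dot R w (col R (codeword x) l) ≈ 0#
      reps⊥cols (i , i∈S , ≡.refl) l = trans (dot-col-codeword (u i) x l) (x∈ker ((i , i∈S) , l))

    colsp-perp⇒kernel : {x : Vect R (Fin k)} →
      (∀ v → colsp R (codeword x) v → Perp R (SpanReps R u S) v) → Kernel (blockRow R T u S) x
    colsp-perp⇒kernel {x} cols⊥reps ((i , i∈S) , l) =
      trans (sym (dot-col-codeword (u i) x l))
            (cols⊥reps (col R (codeword x) l) (generator∈span (col R (codeword x)) l) (u i) uᵢ∈⟨u⟩)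
      where
      uᵢ∈⟨u⟩ : SpanReps R u S (u i)
      uᵢ∈⟨u⟩ = 1 , (λ _ → u i) , (λ _ → i , i∈S , ≡.refl) , generator∈span (λ _ → u i) zero

    codeIn-perp-dim : {d : ℕ} → LinIndep R (slice R T) → IsDim R (Kernel (blockRow R T u S)) d →
      IsDim R (CodeIn R T (Perp R (SpanReps R u S))) d
    codeIn-perp-dim slices-indep kernel-dim = IsDim-image slices-indep kernel-dim
      (λ {x} x∈ker → (x , λ _ → refl) , kernel⇒colsp-perp x∈ker)
      (λ { ((x , M≋) , cols⊥reps) →
           x , colsp-perp⇒kernel (λ v → cols⊥reps v ∘ span-cong (λ l b → sym (M≋ (b , l)))) , M≋ })

open import Data.Nat using (_+_; _*_; _∸_; _^_)

theorem3p6 : ∀ {c ℓ} (F : CommutativeRing c ℓ) → IsField F →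
    (q : ℕ) → IsPrimePower q → HasCard F q →
    (n m k : ℕ) → 2 ≤ n → 1 ≤ m →
    (T : Tensor F k n m) → IsDim F (Code F T) k → Nondegenerate F T →
    (N : ℕ) → N * (q ∸ 1) ≡ q ^ n ∸ 1 → (u : Fin N → Vect F (Fin n)) → ProjReps F u →
    (S : Subset N) →
    Σ ℕ λ d → Σ ℕ λ e →
      IsDim F (CodeIn F T (Perp F (SpanReps F u S))) d ×
      IsDim F (BlockRowsp F T u S) e ×
      (d + e ≡ k)
theorem3p6 F isField q _ card n m k _ _ T code-dim _ N _ u _ S =
  nullity , rank , codeIn-perp-dim u S slices-indep kernel-dim , span-dim , nullity+rank
  where
  open FiniteField F isField card
  open TensorCodes F T
  slices-indep : LinIndep F (slice F T)
  slices-indep = dim-span⇒LinIndep (Searchable-× Searchable-Fin Searchable-Fin) code-dim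
  open RankNullity (rank-nullity (Searchable-× (Searchable-subset S) Searchable-Fin) (blockRow F T u S))
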